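{- Let $G$ be a graph on $n\ge1$ vertices, let $T$ be the vertex set of an attached star in $G$, and let $H=G-T$. Then $\mathbb{E}\rho(G)-1<\mathbb{E}\rho(H)\le\mathbb{E}\rho(G)-1+2^{1-|T|}$.
   Context: Graphs are finite and simple. $\rho_G(X)$ is the binary rank of the $X\times(V(G)\setminus X)$ adjacency submatrix; $\mathbb{E}\rho(G)=2^{ -|V(G)|}\sum_{S\subseteq V(G)}\rho_G(S)$. An attached star in $G$ is an induced subgraph $G[S]$ isomorphic to a star $K_{1,k}$ ($k\ge0$, with a designated central vertex) such that every noncentral vertex of it has no neighbor in $V(G)\setminus S$. -}

module Defs where

open import Data.Bool using (Bool; true; false; not; _∧_; _∨_; _xor_; if_then_else_)
open import Data.Nat using (ℕ; zero; suc; _^_; _⊔_)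
open import Data.Nat.Properties using (m^n≢0)
open import Data.Fin using (Fin)
open import Data.Vec using (Vec; []; _∷_; lookup)
open import Data.List using (List; []; _∷_; map; _++_; foldr; allFin; [_])
open import Data.Bool.ListAction using (and; or)
open import Data.Nat.ListAction using (sum)
open import Data.Fin.Subset using (Subset; _∈_; _∉_; ∣_∣)
open import Data.Integer using (+_)
open import Data.Rational using (ℚ; _/_)
open import Data.Product using (Σ; _×_)
open import Relation.Binary.PropositionalEquality using (_≡_; _≢_)

-- A finite simple graph on vertex set Fin n (Bool-valued adjacency = GF(2) entries).
record Graph (n : ℕ) : Set where
  field
    adj    : Fin n → Fin n → Bool
    sym    : ∀ u v → adj u v ≡ adj v u
    irrefl : ∀ v → adj v v ≡ false
open Graph public

allSubsets : (n : ℕ) → List (Subset n)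
allSubsets zero = [ [] ]
allSubsets (suc n) = map (false ∷_) (allSubsets n) ++ map (true ∷_) (allSubsets n)

subsetB : ∀ {n} → Subset n → Subset n → Bool
subsetB {n} A B = and (map (λ i → not (lookup A i) ∨ lookup B i) (allFin n))

subsetsOf : ∀ {n} → Subset n → List (Subset n)
subsetsOf {n} B = Data.List.filterᵇ (λ A → subsetB A B) (allSubsets n)

isEmptyB : ∀ {n} → Subset n → Bool
isEmptyB {n} A = not (or (map (lookup A) (allFin n)))

-- Inside the graph G[U], for X ⊆ U, consider the X × (U \ X) adjacency matrix over GF(2).
-- Column w (with w ∈ U \ X) of the GF(2)-sum of the rows indexed by R ⊆ X:
rowSum : ∀ {n} → Graph n → Subset n → Subset n → Subset n → Fin n → Bool
rowSum {n} G U X R w =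
  lookup U w ∧ not (lookup X w) ∧
  foldr _xor_ false (map (λ v → lookup R v ∧ adj G v w) (allFin n))

nonzeroSum : ∀ {n} → Graph n → Subset n → Subset n → Subset n → Bool
nonzeroSum {n} G U X R = or (map (rowSum G U X R) (allFin n))

independentB : ∀ {n} → Graph n → Subset n → Subset n → Subset n → Bool
independentB G U X R = and (map (λ R' → isEmptyB R' ∨ nonzeroSum G U X R') (subsetsOf R))

-- ρ_{G[U]}(X): binary rank of the X × (U \ X) adjacency matrix of G[U]
-- = maximum number of GF(2)-linearly independent rows.
cutRank : ∀ {n} → Graph n → Subset n → Subset n → ℕ
cutRank G U X =
  foldr _⊔_ 0 (map (λ R → if independentB G U X R then ∣ R ∣ else 0) (subsetsOf X))

over2^ : ℕ → ℕ → ℚ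
over2^ a k = _/_ (+ a) (2 ^ k) {{m^n≢0 2 k}}

Eρ : ∀ {n} → Graph n → Subset n → ℚ
Eρ G U = over2^ (sum (map (cutRank G U) (subsetsOf U))) ∣ U ∣

-- T is the vertex set of an attached star with center c:
-- G[T] ≅ K_{1,k} with center c, and noncentral vertices have no neighbours outside T.
AttachedStar : ∀ {n} → Graph n → Subset n → Set
AttachedStar {n} G T = Σ (Fin n) λ c →
  c ∈ T ×
  (∀ v → v ∈ T → v ≢ c → adj G c v ≡ true) ×
  (∀ u v → u ∈ T → v ∈ T → u ≢ c → v ≢ c → adj G u v ≡ false) ×
  (∀ v w → v ∈ T → v ≢ c → w ∉ T → adj G v w ≡ false)

-- For S ⊆ V, the cut matrix of S in G is that of S ∖ T in H = G - T, extended by the rows of S ∩ T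
-- and the columns of T ∖ S.  Leaves see only the centre c, so every added row and column vanishes
-- except the row of c (if c ∈ S) or the column of c (if c ∉ S).  Deleting one row or one column lowers
-- a GF(2) rank by at most one, so ρ_H(S ∖ T) ≤ ρ_G(S) ≤ ρ_H(S ∖ T) + 1.  When S ∩ T is neither ∅ nor T,
-- a leaf on the other side of the cut from c contributes a unit row or column, and then
-- ρ_G(S) = ρ_H(S ∖ T) + 1.  Summing over all S, in which each B ⊆ V ∖ T occurs 2^|T| times as S ∖ T,
-- gives 2^|T| Σ ρ_H + 2^n - 2·2^(n-|T|) ≤ Σ ρ_G < 2^|T| Σ ρ_H + 2^n (strict because ρ_G(∅) = 0);
-- dividing by 2^n yields both bounds.

module Submission where

open import Defs hiding (sym)

module CutRank where

  open import Algebra.Bundles using (CommutativeRing)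
  open import Data.Bool using (Bool; true; false; not; _∧_; _∨_; _xor_; T; if_then_else_)
  open import Data.Bool.Properties
    using (xor-assoc; xor-comm; xor-identityʳ; ∧-distribʳ-xor; xor-∧-commutativeRing; not-involutive; T-≡; T-∨)
    renaming (_≟_ to _≟ᵇ_)
  open import Algebra.Properties.CommutativeSemigroup
    (CommutativeRing.+-commutativeSemigroup xor-∧-commutativeRing)
    using () renaming (interchange to xor-interchange)
  open import Data.Bool.ListAction using (all; any)
  open import Data.Nat using (ℕ; zero; suc; _+_; _*_; _^_; _⊔_; _≤_; _<_; z≤n; s≤s)
  open import Data.Nat.Properties
    using (≤-refl; ≤-reflexive; ≤-trans; n≤1+n; m≤n⇒m≤1+n; m≤m+n; m≤n+m; m≤m⊔n; m≤n⊔m; ⊔-lub; ⊔-sel;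
           +-comm; +-identityʳ; +-mono-≤; m+[n∸m]≡n; +-mono-<-≤; *-identityʳ; *-zeroʳ; *-distribˡ-+)
  open import Data.Nat.ListAction using (sum)
  open import Data.Nat.ListAction.Properties using (sum-++)
  open import Data.Nat.Tactic.RingSolver using (solve-∀)
  open import Data.Fin using (Fin; zero; suc; _≟_)
  open import Data.Fin.Properties using (suc-injective; all?; any?)
  open import Data.Fin.Subset
  open import Data.Fin.Subset.Properties
  open import Data.Vec using ([]; _∷_; lookup; zipWith; here; there)
  open import Data.Vec.Properties using ([]=⇒lookup; lookup⇒[]=; lookup-zipWith; ≡-dec)
  open import Data.List using (List; []; _∷_; map; foldr; allFin; _++_; filterᵇ)
  open import Data.List.Properties using (map-tabulate; map-cong; map-∘; map-++; filter-++)
  open import Data.List.Membership.Propositional using (lose) renaming (_∈_ to _∈ₗ_)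
  open import Data.List.Membership.Propositional.Properties
    using (∈-allFin; ∈-map⁺; ∈-++⁺ˡ; ∈-++⁺ʳ; ∈-filter⁺; ∈-filter⁻)
  open import Data.List.Relation.Unary.All as All using (All)
  open import Data.List.Relation.Unary.All.Properties using (all⁺; all⁻; tabulate⁺; tabulate⁻)
  import Data.List.Relation.Unary.Any as Any
  open import Data.List.Relation.Unary.Any.Properties using (any⁺; any⁻)
  open import Data.Product using (∃-syntax; _×_; _,_; proj₂)
  open import Data.Sum using (_⊎_; inj₁; inj₂)
  open import Data.Empty using (⊥-elim)
  open import Function using (_∘_; id; Equivalence)
  open import Relation.Nullary using (¬_; Dec; yes; no; does; contradiction; ¬?; _×-dec_; _→-dec_)
  open import Relation.Nullary.Decidable using (T?; dec-true; decidable-stable)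
  open import Relation.Binary.PropositionalEquality
  open ≡-Reasoning

  private
    variable
      A : Set
      n : ℕ
      x y : Fin n
      p q : Subset n

  xorSum : ∀ {n} → (Fin n → Bool) → Bool
  xorSum {n} f = foldr _xor_ false (map f (allFin n))

  foldr-allFin-suc : ∀ {n} (_∙_ : A → A → A) (e : A) (f : Fin (suc n) → A) →
    foldr _∙_ e (map f (allFin (suc n))) ≡ f zero ∙ foldr _∙_ e (map (f ∘ suc) (allFin n))
  foldr-allFin-suc {n = n} _∙_ e f = cong (λ l → f zero ∙ foldr _∙_ e l)
    (trans (map-tabulate suc f) (sym (map-tabulate id (f ∘ suc))))

  xorSum-suc : ∀ {n} (f : Fin (suc n) → Bool) → xorSum f ≡ f zero xor xorSum (f ∘ suc)
  xorSum-suc = foldr-allFin-suc _xor_ false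

  xorSum-cong : ∀ {n} {f g : Fin n → Bool} → (∀ i → f i ≡ g i) → xorSum f ≡ xorSum g
  xorSum-cong {n} f≗g = cong (foldr _xor_ false) (map-cong f≗g (allFin n))

  xorSum-false : ∀ {n} (f : Fin n → Bool) → (∀ i → f i ≡ false) → xorSum f ≡ false
  xorSum-false {zero}  f f≗0 = refl
  xorSum-false {suc n} f f≗0 = begin
    xorSum f                     ≡⟨ xorSum-suc f ⟩
    f zero xor xorSum (f ∘ suc)  ≡⟨ cong₂ _xor_ (f≗0 zero) (xorSum-false (f ∘ suc) (f≗0 ∘ suc)) ⟩
    false                        ∎

  xorSum-xor : ∀ {n} (f g : Fin n → Bool) → xorSum (λ i → f i xor g i) ≡ xorSum f xor xorSum g
  xorSum-xor {zero}  f g = refl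
  xorSum-xor {suc n} f g = begin
    xorSum (λ i → f i xor g i)
      ≡⟨ xorSum-suc (λ i → f i xor g i) ⟩
    (f zero xor g zero) xor xorSum (λ i → f (suc i) xor g (suc i))
      ≡⟨ cong ((f zero xor g zero) xor_) (xorSum-xor (f ∘ suc) (g ∘ suc)) ⟩
    (f zero xor g zero) xor (xorSum (f ∘ suc) xor xorSum (g ∘ suc))
      ≡⟨ xor-interchange (f zero) (g zero) _ _ ⟩
    (f zero xor xorSum (f ∘ suc)) xor (g zero xor xorSum (g ∘ suc))
      ≡⟨ sym (cong₂ _xor_ (xorSum-suc f) (xorSum-suc g)) ⟩
    xorSum f xor xorSum g
      ∎

  xorSum-pick : ∀ {n} (f g : Fin n → Bool) (x : Fin n) →
    (∀ i → i ≢ x → f i ≡ g i) → g x ≡ false → xorSum f ≡ xorSum g xor f x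
  xorSum-pick {suc n} f g zero f≈g g0≡0 = begin
    xorSum f                       ≡⟨ xorSum-suc f ⟩
    f zero xor xorSum (f ∘ suc)    ≡⟨ cong (f zero xor_) (xorSum-cong (λ i → f≈g (suc i) λ ())) ⟩
    f zero xor xorSum (g ∘ suc)    ≡⟨ xor-comm (f zero) _ ⟩
    xorSum (g ∘ suc) xor f zero    ≡⟨ cong (λ b → (b xor xorSum (g ∘ suc)) xor f zero) g0≡0 ⟨
    (g zero xor xorSum (g ∘ suc)) xor f zero ≡⟨ cong (_xor f zero) (xorSum-suc g) ⟨
    xorSum g xor f zero            ∎
  xorSum-pick {suc n} f g (suc x) f≈g gx≡0 = begin
    xorSum f
      ≡⟨ xorSum-suc f ⟩
    f zero xor xorSum (f ∘ suc)
      ≡⟨ cong₂ _xor_ (f≈g zero λ ())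
           (xorSum-pick (f ∘ suc) (g ∘ suc) x (λ i i≢x → f≈g (suc i) (i≢x ∘ suc-injective)) gx≡0) ⟩
    g zero xor (xorSum (g ∘ suc) xor f (suc x))
      ≡⟨ sym (xor-assoc (g zero) _ _) ⟩
    (g zero xor xorSum (g ∘ suc)) xor f (suc x)
      ≡⟨ cong (_xor f (suc x)) (sym (xorSum-suc g)) ⟩
    xorSum g xor f (suc x)
      ∎

  ∉⇒lookup≡false : x ∉ p → lookup p x ≡ false
  ∉⇒lookup≡false {x = x} {p} x∉p with lookup p x in eq
  ... | true  = contradiction (lookup⇒[]= x p eq) x∉p
  ... | false = refl

  lookup≡false⇒∉ : lookup p x ≡ false → x ∉ p
  lookup≡false⇒∉ px≡0 x∈p with () ← trans (sym ([]=⇒lookup x∈p)) px≡0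

  lookup-cong-∈ : (x ∈ p → x ∈ q) → (x ∈ q → x ∈ p) → lookup p x ≡ lookup q x
  lookup-cong-∈ {x = x} {p} {q} p⇒q q⇒p with lookup p x in eqp | lookup q x in eqq
  ... | true  | true  = refl
  ... | false | false = refl
  ... | true  | false = contradiction (p⇒q (lookup⇒[]= x p eqp)) (lookup≡false⇒∉ eqq)
  ... | false | true  = contradiction (q⇒p (lookup⇒[]= x q eqq)) (lookup≡false⇒∉ eqp)

  x∉p-x : ∀ (p : Subset n) x → x ∉ p - x
  x∉p-x (s ∷ p) zero    ()
  x∉p-x (s ∷ p) (suc x) (there x∈p-x) = x∉p-x p x x∈p-x

  x∈p-y⇒x∈p : x ∈ p - y → x ∈ p
  x∈p-y⇒x∈p {p = p} {y} = p─q⊆p p ⁅ y ⁆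

  x∈p-y⇒x≢y : x ∈ p - y → x ≢ y
  x∈p-y⇒x≢y {p = p} x∈p-y refl = x∉p-x p _ x∈p-y

  x∈p─q⇒x∉q : ∀ (p q : Subset n) → x ∈ p ─ q → x ∉ q
  x∈p─q⇒x∉q (s ∷ p) (outside ∷ q) here          ()
  x∈p─q⇒x∉q (s ∷ p) (outside ∷ q) (there x∈p─q) (there x∈q) = x∈p─q⇒x∉q p q x∈p─q x∈q
  x∈p─q⇒x∉q (s ∷ p) (inside ∷ q)  (there x∈p─q) (there x∈q) = x∈p─q⇒x∉q p q x∈p─q x∈q

  ∣p∪⁅x⁆∣≤1+∣p∣ : ∀ (p : Subset n) x → ∣ p ∪ ⁅ x ⁆ ∣ ≤ suc ∣ p ∣
  ∣p∪⁅x⁆∣≤1+∣p∣ (outside ∷ p) zero    rewrite ∪-identityʳ p = ≤-refl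
  ∣p∪⁅x⁆∣≤1+∣p∣ (inside  ∷ p) zero    rewrite ∪-identityʳ p = n≤1+n _
  ∣p∪⁅x⁆∣≤1+∣p∣ (outside ∷ p) (suc x) = ∣p∪⁅x⁆∣≤1+∣p∣ p x
  ∣p∪⁅x⁆∣≤1+∣p∣ (inside  ∷ p) (suc x) = s≤s (∣p∪⁅x⁆∣≤1+∣p∣ p x)

  ∣p∣≤1+∣p-x∣ : ∀ (p : Subset n) x → ∣ p ∣ ≤ suc ∣ p - x ∣
  ∣p∣≤1+∣p-x∣ p x = ≤-trans (p⊆q⇒∣p∣≤∣q∣ p⊆p-x∪⁅x⁆) (∣p∪⁅x⁆∣≤1+∣p∣ (p - x) x)
    where
    p⊆p-x∪⁅x⁆ : p ⊆ (p - x) ∪ ⁅ x ⁆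
    p⊆p-x∪⁅x⁆ {y} y∈p with y ≟ x
    ... | yes refl = x∈p∪q⁺ (inj₂ (x∈⁅x⁆ x))
    ... | no  y≢x  = x∈p∪q⁺ (inj₁ (x∈p∧x≢y⇒x∈p-y y∈p y≢x))

  x∉p⇒∣p∣<∣p∪⁅x⁆∣ : x ∉ p → ∣ p ∣ < ∣ p ∪ ⁅ x ⁆ ∣
  x∉p⇒∣p∣<∣p∪⁅x⁆∣ {x = x} x∉p = p⊂q⇒∣p∣<∣q∣ (p⊆p∪q ⁅ x ⁆ , x , x∈p∪q⁺ (inj₂ (x∈⁅x⁆ x)) , x∉p)

  x∈p∪⁅y⁆∧x≢y⇒x∈p : x ∈ p ∪ ⁅ y ⁆ → x ≢ y → x ∈ p
  x∈p∪⁅y⁆∧x≢y⇒x∈p {p = p} {y} x∈ x≢y with x∈p∪q⁻ p ⁅ y ⁆ x∈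
  ... | inj₁ x∈p   = x∈p
  ... | inj₂ x∈⁅y⁆ = contradiction (x∈⁅y⁆⇒x≡y y x∈⁅y⁆) x≢y

  ∁-involutive : ∀ (p : Subset n) → ∁ (∁ p) ≡ p
  ∁-involutive []      = refl
  ∁-involutive (s ∷ p) = cong₂ _∷_ (not-involutive s) (∁-involutive p)

  p⊆q∪⁅x⁆∧x∉p⇒p⊆q : p ⊆ q ∪ ⁅ x ⁆ → x ∉ p → p ⊆ q
  p⊆q∪⁅x⁆∧x∉p⇒p⊆q p⊆q+x x∉p y∈p = x∈p∪⁅y⁆∧x≢y⇒x∈p (p⊆q+x y∈p) λ { refl → x∉p y∈p }

  p⊆q∪⁅x⁆⇒p-x⊆q : p ⊆ q ∪ ⁅ x ⁆ → p - x ⊆ q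
  p⊆q∪⁅x⁆⇒p-x⊆q p⊆q+x y∈p-x = x∈p∪⁅y⁆∧x≢y⇒x∈p (p⊆q+x (x∈p-y⇒x∈p y∈p-x)) (x∈p-y⇒x≢y y∈p-x)

  infixr 6 _⊕_

  _⊕_ : Subset n → Subset n → Subset n
  p ⊕ q = zipWith _xor_ p q

  x∈p⊕q⁻ : ∀ (p q : Subset n) → x ∈ p ⊕ q → x ∈ p ⊎ x ∈ q
  x∈p⊕q⁻ (inside  ∷ p) (outside ∷ q) here = inj₁ here
  x∈p⊕q⁻ (outside ∷ p) (inside ∷ q) here = inj₂ here
  x∈p⊕q⁻ (s ∷ p) (t ∷ q) (there x∈) with x∈p⊕q⁻ p q x∈
  ... | inj₁ x∈p = inj₁ (there x∈p)
  ... | inj₂ x∈q = inj₂ (there x∈q)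

  x∉p∧x∈q⇒x∈p⊕q : x ∉ p → x ∈ q → x ∈ p ⊕ q
  x∉p∧x∈q⇒x∈p⊕q {p = outside ∷ p} {inside ∷ q} x∉p here = here
  x∉p∧x∈q⇒x∈p⊕q {p = inside  ∷ p} {inside ∷ q} x∉p here = contradiction here x∉p
  x∉p∧x∈q⇒x∈p⊕q {p = s ∷ p} {t ∷ q} x∉p (there x∈q) = there (x∉p∧x∈q⇒x∈p⊕q (x∉p ∘ there) x∈q)

  -- Rank of a Boolean matrix over GF(2)

  module _ {m k : ℕ} (M : Fin m → Fin k → Bool) where

    rowsSum : Subset m → Fin k → Bool
    rowsSum P w = xorSum (λ v → lookup P v ∧ M v w)

    Dependent : Subset k → Subset m → Set
    Dependent C P = Nonempty P × (∀ w → w ∈ C → rowsSum P w ≡ false)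

    Independent : Subset k → Subset m → Set
    Independent C R = ∀ {P} → P ⊆ R → ¬ Dependent C P

    RankAtMost : Subset m → Subset k → ℕ → Set
    RankAtMost X C b = ∀ {R} → R ⊆ X → Independent C R → ∣ R ∣ ≤ b

    private
      variable
        P Q R X : Subset m
        C C' : Subset k
        w : Fin k
        b : ℕ

    rowsSum-vanishing : (∀ {v} → v ∈ P → M v w ≡ false) → rowsSum P w ≡ false
    rowsSum-vanishing {P} {w} vanish = xorSum-false _ term
      where
      term : ∀ v → lookup P v ∧ M v w ≡ false
      term v with lookup P v in eq
      ... | false = refl
      ... | true  = vanish (lookup⇒[]= v P eq)

    rowsSum-minus : x ∈ P → rowsSum P w ≡ rowsSum (P - x) w xor M x w
    rowsSum-minus {x} {P} {w} x∈P = trans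
      (xorSum-pick _ _ x
        (λ v v≢x → cong (_∧ M v w) (lookup-cong-∈ {p = P} {q = P - x} (λ v∈P → x∈p∧x≢y⇒x∈p-y v∈P v≢x) x∈p-y⇒x∈p))
        (cong (_∧ M x w) (∉⇒lookup≡false (x∉p-x P x))))
      (cong (λ b → rowsSum (P - x) w xor (b ∧ M x w)) ([]=⇒lookup x∈P))

    rowsSum-⊕ : ∀ P Q → rowsSum (P ⊕ Q) w ≡ rowsSum P w xor rowsSum Q w
    rowsSum-⊕ {w} P Q = trans
      (xorSum-cong λ v → trans (cong (_∧ M v w) (lookup-zipWith _xor_ v P Q))
                                (∧-distribʳ-xor (M v w) (lookup P v) (lookup Q v)))
      (xorSum-xor (λ v → lookup P v ∧ M v w) (λ v → lookup Q v ∧ M v w))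

    dependent? : ∀ C P → Dec (Dependent C P)
    dependent? C P = nonempty? P ×-dec all? (λ w → w ∈? C →-dec rowsSum P w ≟ᵇ false)

    independent-⊥ : Independent C ⊥
    independent-⊥ P⊆⊥ ((_ , v∈P) , _) = ∉⊥ (P⊆⊥ v∈P)

    independent-⊆ : Q ⊆ R → Independent C R → Independent C Q
    independent-⊆ Q⊆R indR P⊆Q = indR (Q⊆R ∘ P⊆Q)

    independent-monoCols : C ⊆ C' → Independent C R → Independent C' R
    independent-monoCols C⊆C' indR P⊆R (P≢∅ , P≈0) = indR P⊆R (P≢∅ , λ w w∈C → P≈0 w (C⊆C' w∈C))

    independent-zeroRow : Independent C R → (∀ w → w ∈ C → M x w ≡ false) → x ∉ R
    independent-zeroRow {x = x} indR x≈0 x∈R =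
      indR ⁅x⁆⊆R ((x , x∈⁅x⁆ x) , λ w w∈C → rowsSum-vanishing (⁅x⁆≈0 w w∈C))
      where
      ⁅x⁆⊆R : ⁅ x ⁆ ⊆ _
      ⁅x⁆⊆R v∈⁅x⁆ rewrite x∈⁅y⁆⇒x≡y x v∈⁅x⁆ = x∈R
      ⁅x⁆≈0 : ∀ w → w ∈ _ → ∀ {v} → v ∈ ⁅ x ⁆ → M v w ≡ false
      ⁅x⁆≈0 w w∈C v∈⁅x⁆ rewrite x∈⁅y⁆⇒x≡y x v∈⁅x⁆ = x≈0 w w∈C

    rankAtMost-minusRow : RankAtMost (X - x) C b → RankAtMost X C (suc b)
    rankAtMost-minusRow {X} {x} bound {R} R⊆X indR =
      ≤-trans (∣p∣≤1+∣p-x∣ R x) (s≤s (bound R-x⊆X-x (independent-⊆ x∈p-y⇒x∈p indR)))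
      where
      R-x⊆X-x : R - x ⊆ X - x
      R-x⊆X-x v∈R-x = x∈p∧x≢y⇒x∈p-y (R⊆X (x∈p-y⇒x∈p v∈R-x)) (x∈p-y⇒x≢y v∈R-x)

    rankAtMost-zeroRows : ∀ {X₀} → (∀ {v} → v ∈ X → v ∉ X₀ → ∀ w → w ∈ C → M v w ≡ false) →
                          RankAtMost X₀ C b → RankAtMost X C b
    rankAtMost-zeroRows {X₀ = X₀} vanish bound {R} R⊆X indR = bound R⊆X₀ indR
      where
      R⊆X₀ : R ⊆ X₀
      R⊆X₀ {v} v∈R with v ∈? X₀
      ... | yes v∈X₀ = v∈X₀
      ... | no  v∉X₀ = contradiction v∈R (independent-zeroRow indR (vanish (R⊆X v∈R) v∉X₀))

    rankAtMost-zeroCols : ∀ {C₀} → (∀ {w} → w ∈ C → w ∉ C₀ → ∀ {v} → v ∈ X → M v w ≡ false) →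
                          RankAtMost X C₀ b → RankAtMost X C b
    rankAtMost-zeroCols {C = C} {C₀ = C₀} vanish bound {R} R⊆X indR = bound R⊆X indR₀
      where
      indR₀ : Independent C₀ R
      indR₀ {P} P⊆R (P≢∅ , P≈0) = indR P⊆R (P≢∅ , P≈0-on-C)
        where
        P≈0-on-C : ∀ w → w ∈ C → rowsSum P w ≡ false
        P≈0-on-C w w∈C with w ∈? C₀
        ... | yes w∈C₀ = P≈0 w w∈C₀
        ... | no  w∉C₀ = rowsSum-vanishing (λ v∈P → vanish w∈C w∉C₀ (R⊆X (P⊆R v∈P)))

    dependent-minusCol⇒rowsSum≡true : Independent C R → P ⊆ R → Dependent (C - w) P → rowsSum P w ≡ true
    dependent-minusCol⇒rowsSum≡true {C} {R} {P} {w} indR P⊆R (P≢∅ , P≈0) with rowsSum P w in Pw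
    ... | true  = refl
    ... | false = ⊥-elim (indR P⊆R (P≢∅ , P≈0-on-C))
      where
      P≈0-on-C : ∀ w' → w' ∈ C → rowsSum P w' ≡ false
      P≈0-on-C w' w'∈C with w' ≟ w
      ... | yes refl = Pw
      ... | no  w'≢w = P≈0 w' (x∈p∧x≢y⇒x∈p-y w'∈C w'≢w)

    -- If R loses independence on C - w, deleting one row q of a dependency Q restores it: a second
    -- dependency P ⊆ R - q would, like Q, sum to one at w, so P ⊕ Q would be a dependency on all of C.
    rankAtMost-minusCol : RankAtMost X (C - w) b → RankAtMost X C (suc b)
    rankAtMost-minusCol {X} {C} {w} bound {R} R⊆X indR
      with anySubset? (λ Q → Q ⊆? R ×-dec dependent? (C - w) Q)
    ... | no ∄Q = m≤n⇒m≤1+n (bound R⊆X (λ P⊆R depP → ∄Q (_ , P⊆R , depP)))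
    ... | yes (Q , Q⊆R , depQ@((q , q∈Q) , Q≈0)) =
      ≤-trans (∣p∣≤1+∣p-x∣ R q) (s≤s (bound (R⊆X ∘ x∈p-y⇒x∈p) indR-q))
      where
      indR-q : Independent (C - w) (R - q)
      indR-q {P} P⊆R-q depP@(_ , P≈0) = indR P⊕Q⊆R ((q , q∈P⊕Q) , P⊕Q≈0)
        where
        P⊆R : P ⊆ R
        P⊆R = x∈p-y⇒x∈p ∘ P⊆R-q
        P⊕Q⊆R : P ⊕ Q ⊆ R
        P⊕Q⊆R v∈P⊕Q with x∈p⊕q⁻ P Q v∈P⊕Q
        ... | inj₁ v∈P = P⊆R v∈P
        ... | inj₂ v∈Q = Q⊆R v∈Q
        q∈P⊕Q : q ∈ P ⊕ Q
        q∈P⊕Q = x∉p∧x∈q⇒x∈p⊕q (x∉p-x R q ∘ P⊆R-q) q∈Q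
        P⊕Q≈0 : ∀ w' → w' ∈ C → rowsSum (P ⊕ Q) w' ≡ false
        P⊕Q≈0 w' w'∈C with w' ≟ w
        ... | yes refl = trans (rowsSum-⊕ P Q) (cong₂ _xor_ (dependent-minusCol⇒rowsSum≡true indR P⊆R depP)
                                                            (dependent-minusCol⇒rowsSum≡true indR Q⊆R depQ))
        ... | no  w'≢w = trans (rowsSum-⊕ P Q) (cong₂ _xor_ (P≈0 w' w'∈C-w) (Q≈0 w' w'∈C-w))
          where w'∈C-w = x∈p∧x≢y⇒x∈p-y w'∈C w'≢w

    independent-∪-privateCol : C ⊆ C' → w ∈ C' → M x w ≡ true → (∀ {v} → v ∈ R → M v w ≡ false) →
                               Independent C R → Independent C' (R ∪ ⁅ x ⁆)
    independent-∪-privateCol {C' = C'} {w} {x} {R} C⊆C' w∈C' xw≡1 Rw≈0 indR {P} P⊆R+x (P≢∅ , P≈0)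
      with x ∈? P
    ... | no  x∉P = indR (p⊆q∪⁅x⁆∧x∉p⇒p⊆q P⊆R+x x∉P) (P≢∅ , λ w' w'∈C → P≈0 w' (C⊆C' w'∈C))
    ... | yes x∈P with () ← begin
      true                          ≡⟨ cong₂ _xor_ (rowsSum-vanishing (Rw≈0 ∘ p⊆q∪⁅x⁆⇒p-x⊆q P⊆R+x)) xw≡1 ⟨
      rowsSum (P - x) w xor M x w   ≡⟨ sym (rowsSum-minus x∈P) ⟩
      rowsSum P w                   ≡⟨ P≈0 w w∈C' ⟩
      false                         ∎

    independent-∪-freshCol : C ⊆ C' → w ∈ C' → M x w ≡ true → (∀ w' → w' ∈ C → M x w' ≡ false) →
                             Independent C R → Independent C' (R ∪ ⁅ x ⁆)
    independent-∪-freshCol {C' = C'} {w} {x} {R} C⊆C' w∈C' xw≡1 xC≈0 indR {P} P⊆R+x (P≢∅ , P≈0)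
      with x ∈? P
    ... | no  x∉P = indR (p⊆q∪⁅x⁆∧x∉p⇒p⊆q P⊆R+x x∉P) (P≢∅ , λ w' w'∈C → P≈0 w' (C⊆C' w'∈C))
    ... | yes x∈P with nonempty? (P - x)
    ...   | yes P-x≢∅ = indR (p⊆q∪⁅x⁆⇒p-x⊆q P⊆R+x) (P-x≢∅ , P-x≈0)
      where
      P-x≈0 : ∀ w' → w' ∈ _ → rowsSum (P - x) w' ≡ false
      P-x≈0 w' w'∈C = begin
        rowsSum (P - x) w'               ≡⟨ sym (xor-identityʳ _) ⟩
        rowsSum (P - x) w' xor false     ≡⟨ cong (rowsSum (P - x) w' xor_) (sym (xC≈0 w' w'∈C)) ⟩
        rowsSum (P - x) w' xor M x w'    ≡⟨ sym (rowsSum-minus x∈P) ⟩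
        rowsSum P w'                     ≡⟨ P≈0 w' (C⊆C' w'∈C) ⟩
        false                            ∎
    ...   | no  P-x≡∅ with () ← begin
      true                          ≡⟨ cong₂ _xor_ (rowsSum-vanishing λ v∈P-x → contradiction (_ , v∈P-x) P-x≡∅) xw≡1 ⟨
      rowsSum (P - x) w xor M x w   ≡⟨ sym (rowsSum-minus x∈P) ⟩
      rowsSum P w                   ≡⟨ P≈0 w w∈C' ⟩
      false                         ∎

  -- cutRank as the size of a largest independent set of rows

  T-allFin⁺ : {f : Fin n → Bool} → T (all f (allFin n)) → ∀ i → T (f i)
  T-allFin⁺ {n} {f} t = tabulate⁻ (all⁺ f (allFin n) t)

  T-allFin⁻ : {f : Fin n → Bool} → (∀ i → T (f i)) → T (all f (allFin n))
  T-allFin⁻ {f = f} t = all⁻ f (tabulate⁺ t)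

  T-anyFin⁺ : {f : Fin n → Bool} → ∀ i → T (f i) → T (any f (allFin n))
  T-anyFin⁺ {f = f} i t = any⁺ f (lose (∈-allFin i) t)

  T-anyFin⁻ : {f : Fin n → Bool} → T (any f (allFin n)) → ∃[ i ] T (f i)
  T-anyFin⁻ {n} {f} t = Any.satisfied (any⁻ f (allFin n) t)

  ∈⇒T : ∀ {x} {p : Subset n} → x ∈ p → T (lookup p x)
  ∈⇒T x∈p rewrite []=⇒lookup x∈p = _

  T⇒∈ : ∀ {x} {p : Subset n} → T (lookup p x) → x ∈ p
  T⇒∈ {x = x} {p} t = lookup⇒[]= x p (Equivalence.to T-≡ t)

  ∈-allSubsets : ∀ (p : Subset n) → p ∈ₗ allSubsets n
  ∈-allSubsets []            = Any.here refl
  ∈-allSubsets (outside ∷ p) = ∈-++⁺ˡ (∈-map⁺ (outside ∷_) (∈-allSubsets p))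
  ∈-allSubsets {suc n} (inside ∷ p) = ∈-++⁺ʳ (map (outside ∷_) (allSubsets n)) (∈-map⁺ (inside ∷_) (∈-allSubsets p))

  T-subsetB⇒⊆ : ∀ {p q : Subset n} → T (subsetB p q) → p ⊆ q
  T-subsetB⇒⊆ {p = p} {q} t {x} x∈p =
    T⇒∈ (subst (λ b → T (not b ∨ lookup q x)) ([]=⇒lookup x∈p) (T-allFin⁺ t x))

  ⊆⇒T-subsetB : ∀ {p q : Subset n} → p ⊆ q → T (subsetB p q)
  ⊆⇒T-subsetB {p = p} {q} p⊆q = T-allFin⁻ pointwise
    where
    pointwise : ∀ x → T (not (lookup p x) ∨ lookup q x)
    pointwise x with lookup p x in e
    ... | false = _
    ... | true  = ∈⇒T (p⊆q (lookup⇒[]= x p e))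

  ∈-subsetsOf⁺ : ∀ {p q : Subset n} → p ⊆ q → p ∈ₗ subsetsOf q
  ∈-subsetsOf⁺ {p = p} {q} p⊆q = ∈-filter⁺ (λ r → T? (subsetB r q)) (∈-allSubsets p) (⊆⇒T-subsetB p⊆q)

  ∈-subsetsOf⁻ : ∀ {p q : Subset n} → p ∈ₗ subsetsOf q → p ⊆ q
  ∈-subsetsOf⁻ {n} {p} {q} p∈ = T-subsetB⇒⊆ (proj₂ (∈-filter⁻ (λ r → T? (subsetB r q)) {xs = allSubsets n} p∈))

  module _ {A : Set} (f : A → ℕ) where

    ≤-foldr-⊔ : ∀ {x xs} → x ∈ₗ xs → f x ≤ foldr _⊔_ 0 (map f xs)
    ≤-foldr-⊔ {xs = y ∷ ys} (Any.here refl) = m≤m⊔n (f y) _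
    ≤-foldr-⊔ {xs = y ∷ ys} (Any.there x∈) = ≤-trans (≤-foldr-⊔ x∈) (m≤n⊔m (f y) _)

    foldr-⊔-≤ : ∀ {b} xs → (∀ {x} → x ∈ₗ xs → f x ≤ b) → foldr _⊔_ 0 (map f xs) ≤ b
    foldr-⊔-≤ []       _     = z≤n
    foldr-⊔-≤ (y ∷ ys) bound = ⊔-lub (bound (Any.here refl)) (foldr-⊔-≤ ys (bound ∘ Any.there))

    foldr-⊔-attained : ∀ xs → foldr _⊔_ 0 (map f xs) ≡ 0 ⊎ ∃[ x ] x ∈ₗ xs × foldr _⊔_ 0 (map f xs) ≡ f x
    foldr-⊔-attained []       = inj₁ refl
    foldr-⊔-attained (y ∷ ys) with ⊔-sel (f y) (foldr _⊔_ 0 (map f ys))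
    ... | inj₁ e = inj₂ (y , Any.here refl , e)
    ... | inj₂ e with foldr-⊔-attained ys
    ...   | inj₁ e₀            = inj₁ (trans e e₀)
    ...   | inj₂ (x , x∈ , eₓ) = inj₂ (x , Any.there x∈ , trans e eₓ)

  module _ (G : Graph n) (U X : Subset n) where

    private
      variable
        P R : Subset n
        w : Fin n

    T-rowSum⁻ : T (rowSum G U X P w) → w ∈ U ─ X × rowsSum (adj G) P w ≡ true
    T-rowSum⁻ {P} {w} t with lookup U w in eU | lookup X w in eX | rowsSum (adj G) P w in eS
    ... | true | false | true = x∈p∧x∉q⇒x∈p─q (lookup⇒[]= w U eU) (lookup≡false⇒∉ eX) , refl

    T-rowSum⁺ : w ∈ U ─ X → rowsSum (adj G) P w ≡ true → T (rowSum G U X P w)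
    T-rowSum⁺ {w} {P} w∈U─X Pw≡1
      rewrite []=⇒lookup (p─q⊆p U X w∈U─X) | ∉⇒lookup≡false (x∈p─q⇒x∉q U X w∈U─X) | Pw≡1 = _

    private
      T-not⇒¬T : ∀ {b} → T (not b) → ¬ T b
      T-not⇒¬T {true} () _

      isEmptyB-nonempty : Nonempty P → ¬ T (isEmptyB P)
      isEmptyB-nonempty (i , i∈P) t = T-not⇒¬T t (T-anyFin⁺ i (∈⇒T i∈P))

    independentB⇒Independent : T (independentB G U X R) → Independent (adj G) (U ─ X) R
    independentB⇒Independent {R} t {P} P⊆R (P≢∅ , P≈0)
      with Equivalence.to T-∨ (All.lookup (all⁺ _ (subsetsOf R) t) (∈-subsetsOf⁺ P⊆R))
    ... | inj₁ P≡∅ = isEmptyB-nonempty P≢∅ P≡∅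
    ... | inj₂ P≢0 with T-rowSum⁻ {P = P} (proj₂ (T-anyFin⁻ {f = rowSum G U X P} P≢0))
    ...   | w∈U─X , Pw≡1 with () ← trans (sym Pw≡1) (P≈0 _ w∈U─X)

    Independent⇒independentB : Independent (adj G) (U ─ X) R → T (independentB G U X R)
    Independent⇒independentB {R} indR = all⁻ _ (All.tabulate λ P∈ → acceptable (∈-subsetsOf⁻ P∈))
      where
      acceptable : P ⊆ R → T (isEmptyB P ∨ nonzeroSum G U X P)
      acceptable {P} P⊆R with nonempty? P
      ... | no P≡∅ = Equivalence.from (T-∨ {isEmptyB P}) (inj₁ empty)
        where
        empty : T (isEmptyB P)
        empty with any (lookup P) (allFin _) in e
        ... | false = _
        ... | true  = contradiction (_ , T⇒∈ (proj₂ (T-anyFin⁻ {f = lookup P} (Equivalence.from T-≡ e)))) P≡∅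
      ... | yes P≢∅ with nonzeroSum G U X P in e
      ...   | true  = Equivalence.from (T-∨ {isEmptyB P}) (inj₂ _)
      ...   | false = contradiction (P≢∅ , P≈0) (indR P⊆R)
        where
        P≈0 : ∀ w → w ∈ U ─ X → rowsSum (adj G) P w ≡ false
        P≈0 w w∈U─X with rowsSum (adj G) P w in eS
        ... | false = refl
        ... | true  with () ← trans (sym (Equivalence.to T-≡ (T-anyFin⁺ w (T-rowSum⁺ {P = P} w∈U─X eS)))) e

    cutRank-≥ : R ⊆ X → Independent (adj G) (U ─ X) R → ∣ R ∣ ≤ cutRank G U X
    cutRank-≥ {R} R⊆X indR = subst (λ b → (if b then ∣ R ∣ else 0) ≤ cutRank G U X)
      (Equivalence.to T-≡ (Independent⇒independentB indR))
      (≤-foldr-⊔ (λ R → if independentB G U X R then ∣ R ∣ else 0) (∈-subsetsOf⁺ R⊆X))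

    cutRank-≤ : ∀ {b} → RankAtMost (adj G) X (U ─ X) b → cutRank G U X ≤ b
    cutRank-≤ bound = foldr-⊔-≤ _ (subsetsOf X) candidate
      where
      candidate : ∀ {R} → R ∈ₗ subsetsOf X → (if independentB G U X R then ∣ R ∣ else 0) ≤ _
      candidate {R} R∈ with independentB G U X R in e
      ... | true  = bound (∈-subsetsOf⁻ R∈) (independentB⇒Independent (Equivalence.from T-≡ e))
      ... | false = z≤n

    cutRank-attained : ∃[ R ] R ⊆ X × Independent (adj G) (U ─ X) R × cutRank G U X ≤ ∣ R ∣
    cutRank-attained with foldr-⊔-attained (λ R → if independentB G U X R then ∣ R ∣ else 0) (subsetsOf X)
    ... | inj₁ rank≡0 = ⊥ , ⊥⊆ , independent-⊥ (adj G) , subst (_≤ ∣ ⊥ {n} ∣) (sym rank≡0) z≤n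
    ... | inj₂ (R , R∈ , rank≡) with independentB G U X R in e
    ...   | true  = R , ∈-subsetsOf⁻ R∈ , independentB⇒Independent (Equivalence.from T-≡ e) , ≤-reflexive rank≡
    ...   | false = ⊥ , ⊥⊆ , independent-⊥ (adj G) , subst (_≤ ∣ ⊥ {n} ∣) (sym rank≡) z≤n

  filterᵇ-map : ∀ {B : Set} (p : B → Bool) (f : A → B) xs → filterᵇ p (map f xs) ≡ map f (filterᵇ (p ∘ f) xs)
  filterᵇ-map p f []       = refl
  filterᵇ-map p f (x ∷ xs) with p (f x)
  ... | true  = cong (f x ∷_) (filterᵇ-map p f xs)
  ... | false = filterᵇ-map p f xs

  filterᵇ-cong : ∀ {p q : A → Bool} → (∀ x → p x ≡ q x) → ∀ xs → filterᵇ p xs ≡ filterᵇ q xs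
  filterᵇ-cong p≗q []       = refl
  filterᵇ-cong {q = q} p≗q (x ∷ xs) rewrite p≗q x with q x
  ... | true  = cong (x ∷_) (filterᵇ-cong p≗q xs)
  ... | false = filterᵇ-cong p≗q xs

  filterᵇ-false : ∀ (xs : List A) → filterᵇ (λ _ → false) xs ≡ []
  filterᵇ-false []       = refl
  filterᵇ-false (x ∷ xs) = filterᵇ-false xs

  subsetB-∷ : ∀ a b (p q : Subset n) → subsetB (a ∷ p) (b ∷ q) ≡ (not a ∨ b) ∧ subsetB p q
  subsetB-∷ a b p q = foldr-allFin-suc _∧_ true (λ i → not (lookup (a ∷ p) i) ∨ lookup (b ∷ q) i)

  subsetsOf-∷ : ∀ b (q : Subset n) → subsetsOf (b ∷ q) ≡
    map (outside ∷_) (subsetsOf q) ++ map (inside ∷_) (filterᵇ (λ p → b ∧ subsetB p q) (allSubsets n))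
  subsetsOf-∷ {n} b q = begin
    filterᵇ sub (map (outside ∷_) subsets ++ map (inside ∷_) subsets)
      ≡⟨ filter-++ (T? ∘ sub) (map (outside ∷_) subsets) (map (inside ∷_) subsets) ⟩
    filterᵇ sub (map (outside ∷_) subsets) ++ filterᵇ sub (map (inside ∷_) subsets)
      ≡⟨ cong₂ _++_ (filterᵇ-map sub (outside ∷_) subsets) (filterᵇ-map sub (inside ∷_) subsets) ⟩
    map (outside ∷_) (filterᵇ (sub ∘ (outside ∷_)) subsets) ++
    map (inside ∷_) (filterᵇ (sub ∘ (inside ∷_)) subsets)
      ≡⟨ cong₂ (λ xs ys → map (outside ∷_) xs ++ map (inside ∷_) ys)
               (filterᵇ-cong (λ p → subsetB-∷ outside b p q) subsets)
               (filterᵇ-cong (λ p → subsetB-∷ inside b p q) subsets) ⟩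
    map (outside ∷_) (subsetsOf q) ++ map (inside ∷_) (filterᵇ (λ p → b ∧ subsetB p q) subsets)
      ∎
    where
    subsets = allSubsets n
    sub = λ p → subsetB p (b ∷ q)

  private
    +-interchange : ∀ a b c d → (a + b) + (c + d) ≡ (a + c) + (b + d)
    +-interchange = solve-∀

    double : ∀ a c → a * c + a * c ≡ 2 * a * c
    double = solve-∀

  sumSubsets : Subset n → (Subset n → ℕ) → ℕ
  sumSubsets []            g = g []
  sumSubsets (outside ∷ q) g = sumSubsets q (g ∘ (outside ∷_))
  sumSubsets (inside  ∷ q) g = sumSubsets q (g ∘ (outside ∷_)) + sumSubsets q (g ∘ (inside ∷_))

  sum-subsetsOf : ∀ (q : Subset n) g → sum (map g (subsetsOf q)) ≡ sumSubsets q g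
  sum-subsetsOf []      g = +-identityʳ (g [])
  sum-subsetsOf (b ∷ q) g = trans split (sum-halves b)
    where
    insides : Bool → List (Subset _)
    insides b = filterᵇ (λ p → b ∧ subsetB p q) (allSubsets _)
    sum-map-∷ : ∀ a xs → sum (map g (map (a ∷_) xs)) ≡ sum (map (g ∘ (a ∷_)) xs)
    sum-map-∷ a xs = cong sum (sym (map-∘ xs))
    split : sum (map g (subsetsOf (b ∷ q))) ≡
            sum (map (g ∘ (outside ∷_)) (subsetsOf q)) + sum (map (g ∘ (inside ∷_)) (insides b))
    split = begin
      sum (map g (subsetsOf (b ∷ q)))
        ≡⟨ cong (sum ∘ map g) (subsetsOf-∷ b q) ⟩
      sum (map g (map (outside ∷_) (subsetsOf q) ++ map (inside ∷_) (insides b)))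
        ≡⟨ cong sum (map-++ g (map (outside ∷_) (subsetsOf q)) (map (inside ∷_) (insides b))) ⟩
      sum (map g (map (outside ∷_) (subsetsOf q)) ++ map g (map (inside ∷_) (insides b)))
        ≡⟨ sum-++ (map g (map (outside ∷_) (subsetsOf q))) _ ⟩
      sum (map g (map (outside ∷_) (subsetsOf q))) + sum (map g (map (inside ∷_) (insides b)))
        ≡⟨ cong₂ _+_ (sum-map-∷ outside (subsetsOf q)) (sum-map-∷ inside (insides b)) ⟩
      sum (map (g ∘ (outside ∷_)) (subsetsOf q)) + sum (map (g ∘ (inside ∷_)) (insides b))
        ∎
    sum-halves : ∀ b → sum (map (g ∘ (outside ∷_)) (subsetsOf q)) + sum (map (g ∘ (inside ∷_)) (insides b)) ≡
                       sumSubsets (b ∷ q) g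
    sum-halves outside = begin
      sum (map (g ∘ (outside ∷_)) (subsetsOf q)) + sum (map (g ∘ (inside ∷_)) (insides outside))
        ≡⟨ cong (λ xs → sum (map (g ∘ (outside ∷_)) (subsetsOf q)) + sum (map (g ∘ (inside ∷_)) xs))
                (filterᵇ-false (allSubsets _)) ⟩
      sum (map (g ∘ (outside ∷_)) (subsetsOf q)) + 0
        ≡⟨ +-identityʳ _ ⟩
      sum (map (g ∘ (outside ∷_)) (subsetsOf q))
        ≡⟨ sum-subsetsOf q _ ⟩
      sumSubsets (outside ∷ q) g
        ∎
    sum-halves inside = cong₂ _+_ (sum-subsetsOf q _) (sum-subsetsOf q _)

  sumSubsets-mono-≤ : ∀ {f g : Subset n → ℕ} q → (∀ p → f p ≤ g p) → sumSubsets q f ≤ sumSubsets q g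
  sumSubsets-mono-≤ []            f≤g = f≤g []
  sumSubsets-mono-≤ (outside ∷ q) f≤g = sumSubsets-mono-≤ q (f≤g ∘ (outside ∷_))
  sumSubsets-mono-≤ (inside  ∷ q) f≤g =
    +-mono-≤ (sumSubsets-mono-≤ q (f≤g ∘ (outside ∷_))) (sumSubsets-mono-≤ q (f≤g ∘ (inside ∷_)))

  sumSubsets-mono-< : ∀ {f g : Subset n → ℕ} q → (∀ p → f p ≤ g p) → f ⊥ < g ⊥ → sumSubsets q f < sumSubsets q g
  sumSubsets-mono-< []            f≤g f⊥<g⊥ = f⊥<g⊥
  sumSubsets-mono-< (outside ∷ q) f≤g f⊥<g⊥ = sumSubsets-mono-< q (f≤g ∘ (outside ∷_)) f⊥<g⊥
  sumSubsets-mono-< (inside  ∷ q) f≤g f⊥<g⊥ =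
    +-mono-<-≤ (sumSubsets-mono-< q (f≤g ∘ (outside ∷_)) f⊥<g⊥) (sumSubsets-mono-≤ q (f≤g ∘ (inside ∷_)))

  sumSubsets-+ : ∀ (f g : Subset n → ℕ) q → sumSubsets q (λ p → f p + g p) ≡ sumSubsets q f + sumSubsets q g
  sumSubsets-+ f g []            = refl
  sumSubsets-+ f g (outside ∷ q) = sumSubsets-+ (f ∘ (outside ∷_)) (g ∘ (outside ∷_)) q
  sumSubsets-+ f g (inside  ∷ q) = trans
    (cong₂ _+_ (sumSubsets-+ (f ∘ (outside ∷_)) (g ∘ (outside ∷_)) q)
               (sumSubsets-+ (f ∘ (inside ∷_)) (g ∘ (inside ∷_)) q))
    (+-interchange (sumSubsets q (f ∘ (outside ∷_))) _ _ _)

  sumSubsets-const : ∀ (q : Subset n) c → sumSubsets q (λ _ → c) ≡ 2 ^ ∣ q ∣ * c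
  sumSubsets-const []            c = sym (+-identityʳ c)
  sumSubsets-const (outside ∷ q) c = sumSubsets-const q c
  sumSubsets-const (inside  ∷ q) c =
    trans (cong₂ _+_ (sumSubsets-const q c) (sumSubsets-const q c)) (double (2 ^ ∣ q ∣) c)

  sumSubsets-∩ : ∀ (u : Subset n) g → sumSubsets ⊤ (λ p → g (p ∩ u)) ≡ 2 ^ ∣ ∁ u ∣ * sumSubsets u g
  sumSubsets-∩ []            g = sym (+-identityʳ (g []))
  sumSubsets-∩ (inside  ∷ u) g = trans
    (cong₂ _+_ (sumSubsets-∩ u (g ∘ (outside ∷_))) (sumSubsets-∩ u (g ∘ (inside ∷_))))
    (sym (*-distribˡ-+ (2 ^ ∣ ∁ u ∣) _ _))
  sumSubsets-∩ (outside ∷ u) g = trans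
    (cong₂ _+_ (sumSubsets-∩ u (g ∘ (outside ∷_))) (sumSubsets-∩ u (g ∘ (outside ∷_))))
    (double (2 ^ ∣ ∁ u ∣) _)

  𝟙[_≡_] : Subset n → Subset n → ℕ
  𝟙[ p ≡ q ] = if does (≡-dec _≟ᵇ_ p q) then 1 else 0

  sumSubsets-𝟙 : ∀ {q p : Subset n} → q ⊆ p → sumSubsets p (λ r → 𝟙[ r ≡ q ]) ≡ 1
  sumSubsets-𝟙 {q = []}          {[]}          _   = refl
  sumSubsets-𝟙 {q = outside ∷ q} {outside ∷ p} q⊆p = sumSubsets-𝟙 (drop-∷-⊆ q⊆p)
  sumSubsets-𝟙 {q = inside  ∷ q} {outside ∷ p} q⊆p with () ← q⊆p here
  sumSubsets-𝟙 {q = outside ∷ q} {inside  ∷ p} q⊆p =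
    cong₂ _+_ (sumSubsets-𝟙 (drop-∷-⊆ q⊆p)) (trans (sumSubsets-const p 0) (*-zeroʳ (2 ^ ∣ p ∣)))
  sumSubsets-𝟙 {q = inside  ∷ q} {inside  ∷ p} q⊆p =
    cong₂ _+_ (trans (sumSubsets-const p 0) (*-zeroʳ (2 ^ ∣ p ∣))) (sumSubsets-𝟙 (drop-∷-⊆ q⊆p))

  𝟙-refl : ∀ (p : Subset n) → 𝟙[ p ≡ p ] ≡ 1
  𝟙-refl p rewrite dec-true (≡-dec _≟ᵇ_ p p) refl = refl

  -- Attached stars

  module AttachedStarCutRanks {n} (G : Graph n) (T : Subset n) (c : Fin n) (c∈T : c ∈ T)
    (center~leaf : ∀ v → v ∈ T → v ≢ c → adj G c v ≡ true)
    (leaf≁leaf : ∀ u v → u ∈ T → v ∈ T → u ≢ c → v ≢ c → adj G u v ≡ false)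
    (leaf≁outside : ∀ v w → v ∈ T → v ≢ c → w ∉ T → adj G v w ≡ false) where

    U : Subset n
    U = ∁ T

    -- ρH S is the paper's ρ_H(S ∖ T), the cut rank of S ∩ U inside G[U].
    ρG ρH : Subset n → ℕ
    ρG S = cutRank G ⊤ S
    ρH S = cutRank G U (S ∩ U)

    private
      variable
        S : Subset n
        l v w : Fin n

      leaf≁ : v ∈ T → v ≢ c → w ≢ c → adj G v w ≡ false
      leaf≁ {v} {w} v∈T v≢c w≢c with w ∈? T
      ... | yes w∈T = leaf≁leaf v w v∈T w∈T v≢c w≢c
      ... | no  w∉T = leaf≁outside v w v∈T v≢c w∉T

      ≁leaf : v ≢ c → w ∈ T → w ≢ c → adj G v w ≡ false
      ≁leaf {v} {w} v≢c w∈T w≢c = trans (Graph.sym G v w) (leaf≁ w∈T w≢c v≢c)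

      leaf~center : l ∈ T → l ≢ c → adj G l c ≡ true
      leaf~center {l} l∈T l≢c = trans (Graph.sym G l c) (center~leaf l l∈T l≢c)

      ∈U⇒≢c : v ∈ U → v ≢ c
      ∈U⇒≢c v∈U refl = x∈∁p⇒x∉p v∈U c∈T

      ∈S∩U⇒≢c : v ∈ S ∩ U → v ≢ c
      ∈S∩U⇒≢c {S = S} = ∈U⇒≢c ∘ p∩q⊆q S U

      ∈S∧∉S∩U⇒∈T : v ∈ S → v ∉ S ∩ U → v ∈ T
      ∈S∧∉S∩U⇒∈T v∈S v∉S∩U = x∉∁p⇒x∈p λ v∈U → v∉S∩U (x∈p∩q⁺ (v∈S , v∈U))

      ∉S∧∉H⇒∈T : w ∉ S → w ∉ U ─ (S ∩ U) → w ∈ T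
      ∉S∧∉H⇒∈T {S = S} w∉S w∉H = x∉∁p⇒x∈p λ w∈U →
        w∉H (x∈p∧x∉q⇒x∈p─q w∈U (w∉S ∘ p∩q⊆p S U))

      ∈⊤─S⇒∉S : w ∈ ⊤ ─ S → w ∉ S
      ∈⊤─S⇒∉S {S = S} = x∈p─q⇒x∉q ⊤ S

      ∉S⇒∈⊤─S : w ∉ S → w ∈ ⊤ ─ S
      ∉S⇒∈⊤─S = x∈p∧x∉q⇒x∈p─q ∈⊤

      colsH⊆colsG : U ─ (S ∩ U) ⊆ ⊤ ─ S
      colsH⊆colsG {S = S} w∈H = ∉S⇒∈⊤─S λ w∈S →
        x∈p─q⇒x∉q U (S ∩ U) w∈H (x∈p∩q⁺ (w∈S , p─q⊆p U (S ∩ U) w∈H))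

      ρH-bound : RankAtMost (adj G) (S ∩ U) (U ─ (S ∩ U)) (ρH S)
      ρH-bound = cutRank-≥ G U (_ ∩ U)

    ρG≤1+ρH : ∀ S → ρG S ≤ suc (ρH S)
    ρG≤1+ρH S with c ∈? S
    ... | yes c∈S = cutRank-≤ G ⊤ S (rankAtMost-minusRow (adj G)
      (rankAtMost-zeroRows (adj G) leafRows (rankAtMost-zeroCols (adj G) leafCols ρH-bound)))
      where
      ≢c : w ∈ ⊤ ─ S → w ≢ c
      ≢c w∈⊤─S refl = ∈⊤─S⇒∉S w∈⊤─S c∈S
      leafRows : v ∈ S - c → v ∉ S ∩ U → ∀ w → w ∈ ⊤ ─ S → adj G v w ≡ false
      leafRows v∈S-c v∉S∩U w w∈⊤─S =
        leaf≁ (∈S∧∉S∩U⇒∈T (x∈p-y⇒x∈p v∈S-c) v∉S∩U) (x∈p-y⇒x≢y v∈S-c) (≢c w∈⊤─S)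
      leafCols : w ∈ ⊤ ─ S → w ∉ U ─ (S ∩ U) → ∀ {v} → v ∈ S ∩ U → adj G v w ≡ false
      leafCols w∈⊤─S w∉H v∈S∩U = ≁leaf (∈S∩U⇒≢c v∈S∩U) (∉S∧∉H⇒∈T (∈⊤─S⇒∉S w∈⊤─S) w∉H) (≢c w∈⊤─S)
    ... | no c∉S = cutRank-≤ G ⊤ S (rankAtMost-minusCol (adj G)
      (rankAtMost-zeroRows (adj G) leafRows (rankAtMost-zeroCols (adj G) leafCols ρH-bound)))
      where
      leafRows : v ∈ S → v ∉ S ∩ U → ∀ w → w ∈ (⊤ ─ S) - c → adj G v w ≡ false
      leafRows v∈S v∉S∩U w w∈C = leaf≁ (∈S∧∉S∩U⇒∈T v∈S v∉S∩U) (λ { refl → c∉S v∈S }) (x∈p-y⇒x≢y w∈C)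
      leafCols : w ∈ (⊤ ─ S) - c → w ∉ U ─ (S ∩ U) → ∀ {v} → v ∈ S ∩ U → adj G v w ≡ false
      leafCols w∈C w∉H v∈S∩U =
        ≁leaf (∈S∩U⇒≢c v∈S∩U) (∉S∧∉H⇒∈T (∈⊤─S⇒∉S (x∈p-y⇒x∈p w∈C)) w∉H) (x∈p-y⇒x≢y w∈C)

    ρH≤ρG : ∀ S → ρH S ≤ ρG S
    ρH≤ρG S = cutRank-≤ G U (S ∩ U) λ R⊆S∩U indR →
      cutRank-≥ G ⊤ S (p∩q⊆p S U ∘ R⊆S∩U) (independent-monoCols (adj G) colsH⊆colsG indR)

    private
      1+ρH≤ρG-by : ∀ {x} → x ∈ S → x ∈ T →
        (∀ {R} → R ⊆ S ∩ U → Independent (adj G) (U ─ (S ∩ U)) R → Independent (adj G) (⊤ ─ S) (R ∪ ⁅ x ⁆)) →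
        suc (ρH S) ≤ ρG S
      1+ρH≤ρG-by {S} {x} x∈S x∈T extend with cutRank-attained G U (S ∩ U)
      ... | R , R⊆S∩U , indR , ρH≤∣R∣ =
        ≤-trans (s≤s ρH≤∣R∣) (≤-trans (x∉p⇒∣p∣<∣p∪⁅x⁆∣ x∉R) (cutRank-≥ G ⊤ S R∪x⊆S (extend R⊆S∩U indR)))
        where
        x∉R : x ∉ R
        x∉R x∈R = x∈∁p⇒x∉p (p∩q⊆q S U (R⊆S∩U x∈R)) x∈T
        R∪x⊆S : R ∪ ⁅ x ⁆ ⊆ S
        R∪x⊆S v∈ with x∈p∪q⁻ R ⁅ x ⁆ v∈
        ... | inj₁ v∈R  = p∩q⊆p S U (R⊆S∩U v∈R)
        ... | inj₂ v∈⁅x⁆ rewrite x∈⁅y⁆⇒x≡y x v∈⁅x⁆ = x∈S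

    1+ρH≤ρG-center : c ∈ S → l ∈ T → l ∉ S → suc (ρH S) ≤ ρG S
    1+ρH≤ρG-center {S} {l} c∈S l∈T l∉S = 1+ρH≤ρG-by c∈S c∈T λ R⊆S∩U →
      independent-∪-privateCol (adj G) colsH⊆colsG (∉S⇒∈⊤─S l∉S) (center~leaf l l∈T l≢c)
        (λ v∈R → ≁leaf (∈S∩U⇒≢c (R⊆S∩U v∈R)) l∈T l≢c)
      where
      l≢c : l ≢ c
      l≢c refl = l∉S c∈S

    1+ρH≤ρG-leaf : c ∉ S → l ∈ T → l ∈ S → suc (ρH S) ≤ ρG S
    1+ρH≤ρG-leaf {S} {l} c∉S l∈T l∈S = 1+ρH≤ρG-by l∈S l∈T λ _ →
      independent-∪-freshCol (adj G) colsH⊆colsG (∉S⇒∈⊤─S c∉S) (leaf~center l∈T l≢c)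
        (λ w w∈H → leaf≁ l∈T l≢c (∈U⇒≢c (p─q⊆p U (S ∩ U) w∈H)))
      where
      l≢c : l ≢ c
      l≢c refl = c∉S l∈S

    private
      1+≤+ : ∀ {a b k} → a ≤ b → 1 ≤ k → suc a ≤ b + k
      1+≤+ {a} {b} {k} a≤b 1≤k = subst (_≤ b + k) (+-comm a 1) (+-mono-≤ a≤b 1≤k)

    -- Positive exactly when S ∩ T is T or ∅: the only S for which ρ_G(S) may fall short of ρ_H(S ∖ T) + 1.
    trivialTrace : Subset n → ℕ
    trivialTrace S = 𝟙[ S ∩ T ≡ T ] + 𝟙[ S ∩ T ≡ ⊥ ]

    1+ρH≤ρG+trivialTrace : ∀ S → suc (ρH S) ≤ ρG S + trivialTrace S
    1+ρH≤ρG+trivialTrace S with c ∈? S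
    ... | yes c∈S with any? (λ l → l ∈? T ×-dec ¬? (l ∈? S))
    ...   | yes (l , l∈T , l∉S) = ≤-trans (1+ρH≤ρG-center c∈S l∈T l∉S) (m≤m+n _ _)
    ...   | no ∄l = 1+≤+ (ρH≤ρG S) (≤-trans (≤-reflexive (sym 𝟙≡1)) (m≤m+n _ _))
      where
      S∩T≡T : S ∩ T ≡ T
      S∩T≡T = ⊆-antisym (p∩q⊆q S T) λ {l} l∈T →
        x∈p∩q⁺ (decidable-stable (l ∈? S) (λ l∉S → ∄l (l , l∈T , l∉S)) , l∈T)
      𝟙≡1 : 𝟙[ S ∩ T ≡ T ] ≡ 1
      𝟙≡1 = trans (cong 𝟙[_≡ T ] S∩T≡T) (𝟙-refl T)
    1+ρH≤ρG+trivialTrace S | no c∉S with any? (λ l → l ∈? T ×-dec l ∈? S)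
    ...   | yes (l , l∈T , l∈S) = ≤-trans (1+ρH≤ρG-leaf c∉S l∈T l∈S) (m≤m+n _ _)
    ...   | no ∄l = 1+≤+ (ρH≤ρG S) (≤-trans (≤-reflexive (sym 𝟙≡1)) (m≤n+m _ _))
      where
      S∩T≡⊥ : S ∩ T ≡ ⊥
      S∩T≡⊥ = Empty-unique λ (l , l∈S∩T) → ∄l (l , p∩q⊆q S T l∈S∩T , p∩q⊆p S T l∈S∩T)
      𝟙≡1 : 𝟙[ S ∩ T ≡ ⊥ ] ≡ 1
      𝟙≡1 = trans (cong 𝟙[_≡ ⊥ ] S∩T≡⊥) (𝟙-refl (⊥ {n}))

    SG SH : ℕ
    SG = sumSubsets ⊤ ρG
    SH = sumSubsets U (cutRank G U)

    n≡∣T∣+∣U∣ : n ≡ ∣ T ∣ + ∣ U ∣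
    n≡∣T∣+∣U∣ = sym (trans (cong (∣ T ∣ +_) (∣∁p∣≡n∸∣p∣ T)) (m+[n∸m]≡n (∣p∣≤n T)))

    Eρ-G : Eρ G ⊤ ≡ over2^ SG (∣ T ∣ + ∣ U ∣)
    Eρ-G = cong₂ over2^ (sum-subsetsOf ⊤ ρG) (trans (∣⊤∣≡n n) n≡∣T∣+∣U∣)

    Eρ-H : Eρ G U ≡ over2^ SH ∣ U ∣
    Eρ-H = cong (λ a → over2^ a ∣ U ∣) (sum-subsetsOf U (cutRank G U))

    private
      sum-1+ρH : sumSubsets ⊤ (λ S → suc (ρH S)) ≡ 2 ^ (∣ T ∣ + ∣ U ∣) + 2 ^ ∣ T ∣ * SH
      sum-1+ρH = trans (sumSubsets-+ (λ _ → 1) ρH ⊤) (cong₂ _+_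
        (trans (sumSubsets-const (⊤ {n}) 1) (trans (*-identityʳ _) (cong (2 ^_) (trans (∣⊤∣≡n n) n≡∣T∣+∣U∣))))
        (trans (sumSubsets-∩ U (cutRank G U)) (cong (λ p → 2 ^ ∣ p ∣ * SH) (∁-involutive T))))

      sum-trivialTrace : sumSubsets ⊤ trivialTrace ≡ 2 ^ ∣ U ∣ * 2
      sum-trivialTrace = begin
        sumSubsets ⊤ trivialTrace
          ≡⟨ sumSubsets-+ (λ S → 𝟙[ S ∩ T ≡ T ]) (λ S → 𝟙[ S ∩ T ≡ ⊥ ]) ⊤ ⟩
        sumSubsets ⊤ (λ S → 𝟙[ S ∩ T ≡ T ]) + sumSubsets ⊤ (λ S → 𝟙[ S ∩ T ≡ ⊥ ])
          ≡⟨ cong₂ _+_ (sumSubsets-∩ T 𝟙[_≡ T ]) (sumSubsets-∩ T 𝟙[_≡ ⊥ ]) ⟩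
        2 ^ ∣ U ∣ * sumSubsets T 𝟙[_≡ T ] + 2 ^ ∣ U ∣ * sumSubsets T 𝟙[_≡ ⊥ ]
          ≡⟨ cong₂ (λ a b → 2 ^ ∣ U ∣ * a + 2 ^ ∣ U ∣ * b)
                   (sumSubsets-𝟙 {q = T} {T} ⊆-refl) (sumSubsets-𝟙 {q = ⊥} {T} ⊥⊆) ⟩
        2 ^ ∣ U ∣ * 1 + 2 ^ ∣ U ∣ * 1
          ≡⟨ sym (*-distribˡ-+ (2 ^ ∣ U ∣) 1 1) ⟩
        2 ^ ∣ U ∣ * 2
          ∎

    sumρG<sum1+ρH : SG < 2 ^ (∣ T ∣ + ∣ U ∣) + 2 ^ ∣ T ∣ * SH
    sumρG<sum1+ρH = subst (SG <_) sum-1+ρH (sumSubsets-mono-< ⊤ ρG≤1+ρH (s≤s (≤-trans ρG⊥≤0 z≤n)))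
      where
      ρG⊥≤0 : ρG ⊥ ≤ 0
      ρG⊥≤0 = cutRank-≤ G ⊤ ⊥ λ R⊆⊥ _ → ≤-trans (p⊆q⇒∣p∣≤∣q∣ R⊆⊥) (≤-reflexive (∣⊥∣≡0 n))

    sum1+ρH≤sumρG+2^∣U∣*2 : 2 ^ (∣ T ∣ + ∣ U ∣) + 2 ^ ∣ T ∣ * SH ≤ SG + 2 ^ ∣ U ∣ * 2
    sum1+ρH≤sumρG+2^∣U∣*2 = subst₂ _≤_ sum-1+ρH
      (trans (sumSubsets-+ ρG trivialTrace ⊤) (cong (SG +_) sum-trivialTrace))
      (sumSubsets-mono-≤ ⊤ 1+ρH≤ρG+trivialTrace)


open CutRank using (module AttachedStarCutRanks)
open import Data.Nat as ℕ using (ℕ; NonZero; _^_)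
import Data.Nat.Properties as ℕ
open import Data.Integer as ℤ using (+_; +≤+; +<+)
import Data.Integer.Properties as ℤ
open import Data.Integer.Tactic.RingSolver using (solve-∀)
open import Data.Fin.Subset using (Subset; ⊤; ∁; ∣_∣)
open import Data.Rational using (_/_; toℚᵘ; 1ℚ; _+_; _-_; -_; _<_; _≤_)
open import Data.Rational.Properties
  using (toℚᵘ-fromℚᵘ; toℚᵘ-injective; toℚᵘ-cancel-<; toℚᵘ-cancel-≤; toℚᵘ-homo-+;
         +-assoc; +-comm; +-inverseʳ; +-identityʳ; +-monoˡ-<; +-monoˡ-≤)
open import Data.Rational.Unnormalised as ℚᵘ using (ℚᵘ; mkℚᵘ; *≡*; *≤*; *<*; 1ℚᵘ)
  renaming (_/_ to _/ᵘ_; _≃_ to _≃ᵘ_)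
import Data.Rational.Unnormalised.Properties as ℚᵘ
open import Data.Product using (_×_; _,_)
open import Relation.Binary.PropositionalEquality

-- Dyadic rationals

toℚᵘ-/ : ∀ i d .{{_ : NonZero d}} → toℚᵘ (i / d) ≃ᵘ i /ᵘ d
toℚᵘ-/ i (ℕ.suc d) = toℚᵘ-fromℚᵘ (mkℚᵘ i d)

/ᵘ-mono-≤ : ∀ {a b} d .{{_ : NonZero d}} → a ℕ.≤ b → + a /ᵘ d ℚᵘ.≤ + b /ᵘ d
/ᵘ-mono-≤ (ℕ.suc d) a≤b = *≤* (ℤ.*-monoʳ-≤-nonNeg (+ ℕ.suc d) (+≤+ a≤b))

/ᵘ-mono-< : ∀ {a b} d .{{_ : NonZero d}} → a ℕ.< b → + a /ᵘ d ℚᵘ.< + b /ᵘ d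
/ᵘ-mono-< (ℕ.suc d) a<b = *<* (ℤ.*-monoʳ-<-pos (+ ℕ.suc d) (+<+ a<b))

/ᵘ-+ : ∀ a b d .{{_ : NonZero d}} → + a /ᵘ d ℚᵘ.+ + b /ᵘ d ≃ᵘ + (a ℕ.+ b) /ᵘ d
/ᵘ-+ a b (ℕ.suc d) = *≡* (begin
  (+ a ℤ.* + ℕ.suc d ℤ.+ + b ℤ.* + ℕ.suc d) ℤ.* + ℕ.suc d  ≡⟨ ring (+ a) (+ b) (+ ℕ.suc d) ⟩
  (+ a ℤ.+ + b) ℤ.* (+ ℕ.suc d ℤ.* + ℕ.suc d)              ≡⟨ cong ((+ a ℤ.+ + b) ℤ.*_) (ℤ.pos-* (ℕ.suc d) (ℕ.suc d)) ⟨
  (+ a ℤ.+ + b) ℤ.* + (ℕ.suc d ℕ.* ℕ.suc d)                ∎)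
  where
  open ≡-Reasoning
  ring : ∀ x y s → (x ℤ.* s ℤ.+ y ℤ.* s) ℤ.* s ≡ (x ℤ.+ y) ℤ.* (s ℤ.* s)
  ring = solve-∀

/ᵘ-self : ∀ d .{{_ : NonZero d}} → + d /ᵘ d ≃ᵘ 1ℚᵘ
/ᵘ-self (ℕ.suc d) = *≡* (trans (ℤ.*-identityʳ (+ ℕ.suc d)) (sym (ℤ.*-identityˡ (+ ℕ.suc d))))

/ᵘ-cong : ∀ {i j d e} .{{_ : NonZero d}} .{{_ : NonZero e}} → i ≡ j → d ≡ e → i /ᵘ d ≡ j /ᵘ e
/ᵘ-cong {d = ℕ.suc d} refl refl = refl

over2^ᵘ : ℕ → ℕ → ℚᵘ
over2^ᵘ a k = (+ a /ᵘ 2 ^ k) {{ℕ.m^n≢0 2 k}}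

toℚᵘ-over2^ : ∀ a k → toℚᵘ (over2^ a k) ≃ᵘ over2^ᵘ a k
toℚᵘ-over2^ a k = toℚᵘ-/ (+ a) (2 ^ k) {{ℕ.m^n≢0 2 k}}

module _ {k : ℕ} where

  private instance
    _ = ℕ.m^n≢0 2 k

  over2^-mono-< : ∀ {a b} → a ℕ.< b → over2^ a k < over2^ b k
  over2^-mono-< {a} {b} a<b = toℚᵘ-cancel-<
    (ℚᵘ.<-respˡ-≃ (ℚᵘ.≃-sym (toℚᵘ-over2^ a k))
      (ℚᵘ.<-respʳ-≃ (ℚᵘ.≃-sym (toℚᵘ-over2^ b k)) (/ᵘ-mono-< (2 ^ k) a<b)))

  over2^-mono-≤ : ∀ {a b} → a ℕ.≤ b → over2^ a k ≤ over2^ b k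
  over2^-mono-≤ {a} {b} a≤b = toℚᵘ-cancel-≤
    (ℚᵘ.≤-respˡ-≃ (ℚᵘ.≃-sym (toℚᵘ-over2^ a k))
      (ℚᵘ.≤-respʳ-≃ (ℚᵘ.≃-sym (toℚᵘ-over2^ b k)) (/ᵘ-mono-≤ (2 ^ k) a≤b)))

  over2^-+ : ∀ a b → over2^ (a ℕ.+ b) k ≡ over2^ a k + over2^ b k
  over2^-+ a b = toℚᵘ-injective (begin
    toℚᵘ (over2^ (a ℕ.+ b) k)                  ≈⟨ toℚᵘ-over2^ (a ℕ.+ b) k ⟩
    + (a ℕ.+ b) /ᵘ 2 ^ k                       ≈⟨ /ᵘ-+ a b (2 ^ k) ⟨
    + a /ᵘ 2 ^ k ℚᵘ.+ + b /ᵘ 2 ^ k             ≈⟨ ℚᵘ.+-cong (toℚᵘ-over2^ a k) (toℚᵘ-over2^ b k) ⟨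
    toℚᵘ (over2^ a k) ℚᵘ.+ toℚᵘ (over2^ b k)   ≈⟨ toℚᵘ-homo-+ (over2^ a k) (over2^ b k) ⟨
    toℚᵘ (over2^ a k + over2^ b k)             ∎)
    where open ℚᵘ.≃-Reasoning

  over2^-self : over2^ (2 ^ k) k ≡ 1ℚ
  over2^-self = toℚᵘ-injective (ℚᵘ.≃-trans (toℚᵘ-over2^ (2 ^ k) k) (/ᵘ-self (2 ^ k)))

over2^-cancelˡ : ∀ a j k → over2^ (2 ^ j ℕ.* a) (j ℕ.+ k) ≡ over2^ a k
over2^-cancelˡ a j k = toℚᵘ-injective (begin
  toℚᵘ (over2^ (2 ^ j ℕ.* a) (j ℕ.+ k))     ≈⟨ toℚᵘ-over2^ (2 ^ j ℕ.* a) (j ℕ.+ k) ⟩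
  + (2 ^ j ℕ.* a) /ᵘ 2 ^ (j ℕ.+ k)          ≡⟨ /ᵘ-cong (ℤ.pos-* (2 ^ j) a) (ℕ.^-distribˡ-+-* 2 j k) ⟩
  (+ 2 ^ j ℤ.* + a) /ᵘ (2 ^ j ℕ.* 2 ^ k)    ≈⟨ ℚᵘ.*-cancelˡ-/ (2 ^ j) ⟩
  + a /ᵘ 2 ^ k                              ≈⟨ toℚᵘ-over2^ a k ⟨
  toℚᵘ (over2^ a k)                         ∎)
  where
  open ℚᵘ.≃-Reasoning
  instance
    _ = ℕ.m^n≢0 2 j
    _ = ℕ.m^n≢0 2 k
    _ = ℕ.m^n≢0 2 (j ℕ.+ k)
    _ = ℕ.m*n≢0 (2 ^ j) (2 ^ k)

private
  +-[-]-cancelʳ : ∀ q r → q + r - r ≡ q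
  +-[-]-cancelʳ q r = trans (+-assoc q r (- r)) (trans (cong (λ x → q + x) (+-inverseʳ r)) (+-identityʳ q))

p<r+q⇒p-r<q : ∀ {p q r} → p < r + q → p - r < q
p<r+q⇒p-r<q {p} {q} {r} p<r+q =
  subst (p - r <_) (+-[-]-cancelʳ q r) (+-monoˡ-< (- r) (subst (p <_) (+-comm r q) p<r+q))

r+q≤p+s⇒q≤p-r+s : ∀ {p q r s} → r + q ≤ p + s → q ≤ p - r + s
r+q≤p+s⇒q≤p-r+s {p} {q} {r} {s} r+q≤p+s =
  subst₂ _≤_ (+-[-]-cancelʳ q r) p+s-r≡p-r+s (+-monoˡ-≤ (- r) (subst (_≤ p + s) (+-comm r q) r+q≤p+s))
  where
  p+s-r≡p-r+s : p + s - r ≡ p - r + s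
  p+s-r≡p-r+s = trans (+-assoc p s (- r)) (trans (cong (λ x → p + x) (+-comm s (- r))) (sym (+-assoc p (- r) s)))

over2^-bounds : ∀ {a b t u} →
  a ℕ.< 2 ^ (t ℕ.+ u) ℕ.+ 2 ^ t ℕ.* b → 2 ^ (t ℕ.+ u) ℕ.+ 2 ^ t ℕ.* b ℕ.≤ a ℕ.+ 2 ^ u ℕ.* 2 →
  (over2^ a (t ℕ.+ u) - 1ℚ < over2^ b u) × (over2^ b u ≤ over2^ a (t ℕ.+ u) - 1ℚ + over2^ 2 t)
over2^-bounds {a} {b} {t} {u} upper lower =
    p<r+q⇒p-r<q {meanG} {meanH} {1ℚ} meanG<1+meanH
  , r+q≤p+s⇒q≤p-r+s {meanG} {meanH} {1ℚ} {over2^ 2 t} 1+meanH≤meanG+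
  where
  meanG = over2^ a (t ℕ.+ u)
  meanH = over2^ b u
  1+meanH : over2^ (2 ^ (t ℕ.+ u) ℕ.+ 2 ^ t ℕ.* b) (t ℕ.+ u) ≡ 1ℚ + meanH
  1+meanH = trans (over2^-+ {t ℕ.+ u} (2 ^ (t ℕ.+ u)) (2 ^ t ℕ.* b))
                  (cong₂ _+_ (over2^-self {t ℕ.+ u}) (over2^-cancelˡ b t u))
  meanG+ : over2^ (a ℕ.+ 2 ^ u ℕ.* 2) (t ℕ.+ u) ≡ meanG + over2^ 2 t
  meanG+ = trans (over2^-+ {t ℕ.+ u} a (2 ^ u ℕ.* 2))
                 (cong (λ r → meanG + r) (trans (cong (over2^ (2 ^ u ℕ.* 2)) (ℕ.+-comm t u)) (over2^-cancelˡ 2 u t)))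
  meanG<1+meanH : meanG < 1ℚ + meanH
  meanG<1+meanH = subst (meanG <_) 1+meanH (over2^-mono-< {t ℕ.+ u} upper)
  1+meanH≤meanG+ : 1ℚ + meanH ≤ meanG + over2^ 2 t
  1+meanH≤meanG+ = subst₂ _≤_ 1+meanH meanG+ (over2^-mono-≤ {t ℕ.+ u} lower)

proposition4p6 : (n : ℕ) → NonZero n → (G : Graph n) (T : Subset n) → AttachedStar G T →
    ((Eρ G ⊤ - 1ℚ) < Eρ G (∁ T)) × (Eρ G (∁ T) ≤ ((Eρ G ⊤ - 1ℚ) + over2^ 2 ∣ T ∣))
proposition4p6 n _ G T (c , c∈T , center~leaf , leaf≁leaf , leaf≁outside) =
  subst₂ (λ x y → (x - 1ℚ < y) × (y ≤ x - 1ℚ + over2^ 2 ∣ T ∣)) (sym Eρ-G) (sym Eρ-H)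
    (over2^-bounds {SG} {SH} {∣ T ∣} {∣ U ∣} sumρG<sum1+ρH sum1+ρH≤sumρG+2^∣U∣*2)
  where open AttachedStarCutRanks G T c c∈T center~leaf leaf≁leaf leaf≁outside
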